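{- Let $N\ge1$ and $\mathbf t=(k_0,\ell_0,\ldots,k_{N-1},\ell_{N-1})\in\overline{\mathbb N}_+^{2N}$. Write \[ M(\mathbf t)=A_1^{k_0}A_0^{\ell_0}A_1^{k_1}A_0^{\ell_1}\cdots A_1^{k_{N-1}}A_0^{\ell_{N-1}}=\begin{pmatrix}\mathfrak a(\alpha,\beta)&\mathfrak b(\alpha,\beta)\\ \mathfrak c(\alpha,\beta)&\mathfrak d(\alpha,\beta)\end{pmatrix} \] with formal power series $\mathfrak a,\mathfrak b,\mathfrak c,\mathfrak d\in\mathbb C[[\alpha,\beta]]$. Then \[ \sum_{i,j\ge0}2^{ -(i+j)}[\alpha^i\beta^j]\bigl(\mathfrak a+\mathfrak b\bigr)=1,\qquad \sum_{i,j\ge0}2^{ -(i+j)}[\alpha^i\beta^j]\bigl(\mathfrak c+\mathfrak d\bigr)=1, \] and all coefficients of $\mathfrak a,\mathfrak b,\mathfrak c,\mathfrak d$ are nonnegative.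
   Context: Let $\overline{\mathbb N}_+=\{1,2,3,\ldots\}\cup\{\infty\}$. Let $\alpha,\beta$ be formal variables and work with $2\times2$ matrices over $\mathbb C[[\alpha,\beta]]$. Put $A_0=\begin{pmatrix}1&0\\ \alpha&\beta\end{pmatrix}$, $A_1=\begin{pmatrix}\alpha&\beta\\0&1\end{pmatrix}$; for finite positive integers $\ell,k$ the powers $A_0^\ell,A_1^k$ are the usual matrix powers, namely $A_0^\ell=\begin{pmatrix}1&0\\ \alpha\frac{1-\beta^\ell}{1-\beta}&\beta^\ell\end{pmatrix}$, $A_1^k=\begin{pmatrix}\alpha^k&\beta\frac{1-\alpha^k}{1-\alpha}\\0&1\end{pmatrix}$, and one defines $A_0^\infty=\begin{pmatrix}1&0\\ \frac{\alpha}{1-\beta}&0\end{pmatrix}$, $A_1^\infty=\begin{pmatrix}0&\frac{\beta}{1-\alpha}\\0&1\end{pmatrix}$ (where $1/(1-\alpha)=\sum_{n\ge0}\alpha^n$ etc.). $[\alpha^i\beta^j]F$ denotes the coefficient of $\alpha^i\beta^j$ in $F$. -}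

module Defs where

open import Data.Nat as ℕ using (ℕ; zero; suc)
open import Data.Bool using (Bool; true; false; if_then_else_)
open import Data.Product using (_×_; _,_)
open import Data.Vec using (Vec; []; _∷_)
open import Data.Rational using (ℚ; 0ℚ; 1ℚ; ½; _+_; _*_)

-- Formal power series in two variables α, β with rational coefficients:
-- F i j is the coefficient [α^i β^j] F.  (All series occurring here have
-- integer coefficients, so ℚ ⊂ ℂ suffices.)
PS : Set
PS = ℕ → ℕ → ℚ

Σ< : ℕ → (ℕ → ℚ) → ℚ
Σ< zero    f = 0ℚ
Σ< (suc n) f = Σ< n f + f n

δ : ℕ → ℚ
δ zero    = 1ℚ
δ (suc _) = 0ℚ

δ₁ : ℕ → ℚ
δ₁ (suc zero) = 1ℚ
δ₁ _          = 0ℚ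

0ₚ 1ₚ αₚ βₚ : PS
0ₚ i j = 0ℚ
1ₚ i j = δ i * δ j
αₚ i j = δ₁ i * δ j
βₚ i j = δ i * δ₁ j

-- 1/(1-α) = Σ α^n  and  1/(1-β) = Σ β^n
geoα geoβ : PS
geoα i j = δ j
geoβ i j = δ i

_+ₚ_ : PS → PS → PS
(F +ₚ G) i j = F i j + G i j

_*ₚ_ : PS → PS → PS
(F *ₚ G) i j = Σ< (suc i) λ a → Σ< (suc j) λ b → F a b * G (i ℕ.∸ a) (j ℕ.∸ b)

infixl 6 _+ₚ_
infixl 7 _*ₚ_

record Mat : Set where
  constructor mat
  field
    a b c d : PS
open Mat public

_⊗_ : Mat → Mat → Mat
mat a₁ b₁ c₁ d₁ ⊗ mat a₂ b₂ c₂ d₂ =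
  mat (a₁ *ₚ a₂ +ₚ b₁ *ₚ c₂) (a₁ *ₚ b₂ +ₚ b₁ *ₚ d₂)
      (c₁ *ₚ a₂ +ₚ d₁ *ₚ c₂) (c₁ *ₚ b₂ +ₚ d₁ *ₚ d₂)
infixl 7 _⊗_

I₂ : Mat
I₂ = mat 1ₚ 0ₚ 0ₚ 1ₚ

A₀ A₁ : Mat
A₀ = mat 1ₚ 0ₚ αₚ βₚ
A₁ = mat αₚ βₚ 0ₚ 1ₚ

pow : Mat → ℕ → Mat
pow M zero    = I₂
pow M (suc n) = M ⊗ pow M n

A₀∞ A₁∞ : Mat
A₀∞ = mat 1ₚ 0ₚ (αₚ *ₚ geoβ) 0ₚ
A₁∞ = mat 0ₚ (βₚ *ₚ geoα) 0ₚ 1ₚ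

-- \overline{ℕ}_+ = {1,2,3,...} ∪ {∞}; fin n stands for the positive integer n+1
data ℕ̄₊ : Set where
  fin : ℕ → ℕ̄₊
  ∞   : ℕ̄₊

val : ℕ → ℕ
val n = suc n

A₀^ A₁^ : ℕ̄₊ → Mat
A₀^ (fin n) = pow A₀ (val n)
A₀^ ∞       = A₀∞
A₁^ (fin n) = pow A₁ (val n)
A₁^ ∞       = A₁∞

M : ∀ {N} → Vec (ℕ̄₊ × ℕ̄₊) N → Mat
M []            = I₂
M ((k , ℓ) ∷ t) = A₁^ k ⊗ A₀^ ℓ ⊗ M t

½^ : ℕ → ℚ
½^ zero    = 1ℚ
½^ (suc n) = ½ * ½^ n

wsum : PS → ℕ → ℚ
wsum F K = Σ< K λ i → Σ< K λ j → ½^ (i ℕ.+ j) * F i j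

module Submission where

-- Substituting α = β = ½ (i.e. taking Σ 2^-(i+j) [α^i β^j]) turns A₀, A₁, A₀^∞, A₁^∞ into
-- row-stochastic matrices, the entries of A^∞ becoming ½ · (1 + ½ + ¼ + ⋯) = 1.  All series
-- involved have nonnegative coefficients, so their value at (½,½) is the supremum of the square
-- partial sums, and this value is additive and multiplicative: the square partial sum of a
-- Cauchy product up to K is at most the product of those of the factors, which is in turn at
-- most the partial sum of the Cauchy product up to 2K.  Hence M(t) evaluates to a product of
-- row-stochastic matrices, whose rows sum to 1.

open import Defs
open import Data.Nat as ℕ using (ℕ; zero; suc; z≤n; s≤s; _∸_; _≥_)
import Data.Nat.Properties as ℕ
open import Data.Integer as ℤ using (+≤+)
import Data.Integer.Properties as ℤ
open import Data.Product using (_×_; Σ; ∃; _,_)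
open import Data.Sum using (inj₁; inj₂)
open import Data.Vec using (Vec; []; _∷_)
open import Data.Rational
  using (ℚ; mkℚ; toℚᵘ; 0ℚ; 1ℚ; ½; _≤_; _-_; _+_; _*_; -_; 1/_; ∣_∣; Positive; NonZero; nonNegative)
open import Data.Rational.Properties
import Data.Rational.Unnormalised as ℚᵘ
import Data.Rational.Unnormalised.Properties as ℚᵘ
open import Data.Rational.Solver using (module +-*-Solver)
open import Algebra.Properties.CommutativeSemigroup ℕ.+-commutativeSemigroup using (interchange)
open import Relation.Binary.PropositionalEquality
open +-*-Solver

*-nonNeg : ∀ {p q} → 0ℚ ≤ p → 0ℚ ≤ q → 0ℚ ≤ p * q
*-nonNeg {p} {q} 0≤p 0≤q =
  nonNegative⁻¹ _ {{nonNeg*nonNeg⇒nonNeg p {{nonNegative 0≤p}} q {{nonNegative 0≤q}}}}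

p≤p+q : ∀ p {q} → 0ℚ ≤ q → p ≤ p + q
p≤p+q p {q} 0≤q = subst (_≤ p + q) (+-identityʳ p) (+-monoʳ-≤ p 0≤q)

*-mono-≤-nonNeg : ∀ {p q r s} → 0ℚ ≤ p → 0ℚ ≤ r → p ≤ q → r ≤ s → p * r ≤ q * s
*-mono-≤-nonNeg {p} {q} {r} {s} 0≤p 0≤r p≤q r≤s =
  ≤-trans (*-monoʳ-≤-nonNeg r {{nonNegative 0≤r}} p≤q)
          (*-monoˡ-≤-nonNeg q {{nonNegative (≤-trans 0≤p p≤q)}} r≤s)

p≤q⇒0≤q-p : ∀ {p q} → p ≤ q → 0ℚ ≤ q - p
p≤q⇒0≤q-p {p} {q} p≤q = subst (_≤ q - p) (+-inverseʳ p) (+-monoˡ-≤ (- p) p≤q)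

p-q≤r⇒p-r≤q : ∀ {p q r} → p - q ≤ r → p - r ≤ q
p-q≤r⇒p-r≤q {p} {q} {r} p-q≤r = subst₂ _≤_
  (solve 3 (λ p q r → (p :- q) :+ (q :- r) := p :- r) refl p q r)
  (solve 3 (λ p q r → r :+ (q :- r) := q) refl p q r)
  (+-monoˡ-≤ (q - r) p-q≤r)

½*p+½*p≡p : ∀ p → ½ * p + ½ * p ≡ p
½*p+½*p≡p p = trans (sym (*-distribʳ-+ p ½ ½)) (*-identityˡ p)

Σ<-cong : ∀ n {f g : ℕ → ℚ} → (∀ k → k ℕ.< n → f k ≡ g k) → Σ< n f ≡ Σ< n g
Σ<-cong zero    f≡g = refl
Σ<-cong (suc n) f≡g = cong₂ _+_ (Σ<-cong n (λ k k<n → f≡g k (ℕ.m<n⇒m<1+n k<n))) (f≡g n ℕ.≤-refl)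

Σ<-zero : ∀ n → Σ< n (λ _ → 0ℚ) ≡ 0ℚ
Σ<-zero zero    = refl
Σ<-zero (suc n) = trans (+-identityʳ _) (Σ<-zero n)

Σ<-+ : ∀ n (f g : ℕ → ℚ) → Σ< n (λ k → f k + g k) ≡ Σ< n f + Σ< n g
Σ<-+ zero    f g = refl
Σ<-+ (suc n) f g = trans (cong (_+ (f n + g n)) (Σ<-+ n f g))
  (solve 4 (λ a b c d → (a :+ b) :+ (c :+ d) := (a :+ c) :+ (b :+ d)) refl (Σ< n f) (Σ< n g) (f n) (g n))

*-Σ< : ∀ n x (f : ℕ → ℚ) → x * Σ< n f ≡ Σ< n (λ k → x * f k)
*-Σ< zero    x f = *-zeroʳ x
*-Σ< (suc n) x f = trans (*-distribˡ-+ x (Σ< n f) (f n)) (cong (_+ x * f n) (*-Σ< n x f))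

Σ<-* : ∀ n x (f : ℕ → ℚ) → Σ< n f * x ≡ Σ< n (λ k → f k * x)
Σ<-* n x f = trans (*-comm (Σ< n f) x) (trans (*-Σ< n x f) (Σ<-cong n (λ k _ → *-comm x (f k))))

Σ<-comm : ∀ m n (φ : ℕ → ℕ → ℚ) → Σ< m (λ i → Σ< n (φ i)) ≡ Σ< n (λ j → Σ< m (λ i → φ i j))
Σ<-comm zero    n φ = sym (Σ<-zero n)
Σ<-comm (suc m) n φ = trans (cong (_+ Σ< n (φ m)) (Σ<-comm m n φ))
  (sym (Σ<-+ n (λ j → Σ< m (λ i → φ i j)) (φ m)))

Σ<-nonNeg : ∀ n {f : ℕ → ℚ} → (∀ k → 0ℚ ≤ f k) → 0ℚ ≤ Σ< n f
Σ<-nonNeg zero    0≤f = ≤-refl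
Σ<-nonNeg (suc n) 0≤f = +-mono-≤ (Σ<-nonNeg n 0≤f) (0≤f n)

Σ<-monoˡ : ∀ {m n} {f : ℕ → ℚ} → m ℕ.≤ n → (∀ k → 0ℚ ≤ f k) → Σ< m f ≤ Σ< n f
Σ<-monoˡ {n = n} z≤n 0≤f = Σ<-nonNeg n 0≤f
Σ<-monoˡ {suc m} {suc n} {f} (s≤s m≤n) 0≤f with ℕ.m≤n⇒m<n∨m≡n m≤n
... | inj₁ m<n  = ≤-trans (Σ<-monoˡ m<n 0≤f) (p≤p+q (Σ< n f) (0≤f n))
... | inj₂ refl = ≤-refl

Σ<-monoʳ : ∀ n {f g : ℕ → ℚ} → (∀ k → k ℕ.< n → f k ≤ g k) → Σ< n f ≤ Σ< n g
Σ<-monoʳ zero    f≤g = ≤-refl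
Σ<-monoʳ (suc n) f≤g = +-mono-≤ (Σ<-monoʳ n (λ k k<n → f≤g k (ℕ.m<n⇒m<1+n k<n))) (f≤g n ℕ.≤-refl)

Σ<-mono : ∀ {m n} {f g : ℕ → ℚ} → m ℕ.≤ n → (∀ k → k ℕ.< m → f k ≤ g k) → (∀ k → 0ℚ ≤ g k) →
          Σ< m f ≤ Σ< n g
Σ<-mono {m} m≤n f≤g 0≤g = ≤-trans (Σ<-monoʳ m f≤g) (Σ<-monoˡ m≤n 0≤g)

Σ<-antidiagonal : ∀ n (φ : ℕ → ℕ → ℚ) →
  Σ< n (λ i → Σ< (suc i) (λ a → φ a (i ∸ a))) ≡ Σ< n (λ a → Σ< (n ∸ a) (φ a))
Σ<-antidiagonal zero    φ = refl
Σ<-antidiagonal (suc n) φ = begin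
  Σ< n (λ i → Σ< (suc i) (λ a → φ a (i ∸ a))) + (D + φ n (n ∸ n))
    ≡⟨ cong₂ (λ s z → s + (D + φ n z)) (Σ<-antidiagonal n φ) (ℕ.n∸n≡0 n) ⟩
  T + (D + φ n 0)
    ≡⟨ sym (+-assoc T D (φ n 0)) ⟩
  (T + D) + φ n 0
    ≡⟨ cong₂ _+_ (sym growRows) (sym (+-identityˡ (φ n 0))) ⟩
  Σ< n (λ a → Σ< (suc n ∸ a) (φ a)) + Σ< 1 (φ n)
    ≡⟨ cong (λ z → Σ< n (λ a → Σ< (suc n ∸ a) (φ a)) + Σ< z (φ n)) (sym (ℕ.m+n∸n≡m 1 n)) ⟩
  Σ< n (λ a → Σ< (suc n ∸ a) (φ a)) + Σ< (suc n ∸ n) (φ n) ∎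
  where
  T = Σ< n (λ a → Σ< (n ∸ a) (φ a))
  D = Σ< n (λ a → φ a (n ∸ a))
  open ≡-Reasoning
  growRows : Σ< n (λ a → Σ< (suc n ∸ a) (φ a)) ≡ T + D
  growRows = trans (Σ<-cong n (λ a a<n → cong (λ z → Σ< z (φ a)) (ℕ.+-∸-assoc 1 (ℕ.<⇒≤ a<n))))
                   (Σ<-+ n _ _)

Σ□ Σ△ : ℕ → PS → ℚ
Σ□ n φ = Σ< n λ a → Σ< n (φ a)
Σ△ n φ = Σ< n λ a → Σ< (n ∸ a) (φ a)

Nonneg : PS → Set
Nonneg φ = ∀ i j → 0ℚ ≤ φ i j

Σ□-nonNeg : ∀ n {φ} → Nonneg φ → 0ℚ ≤ Σ□ n φ
Σ□-nonNeg n 0≤φ = Σ<-nonNeg n λ a → Σ<-nonNeg n (0≤φ a)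

Σ△-nonNeg : ∀ n {φ} → Nonneg φ → 0ℚ ≤ Σ△ n φ
Σ△-nonNeg n 0≤φ = Σ<-nonNeg n λ a → Σ<-nonNeg (n ∸ a) (0≤φ a)

Σ□-monoˡ : ∀ {m n φ} → m ℕ.≤ n → Nonneg φ → Σ□ m φ ≤ Σ□ n φ
Σ□-monoˡ {n = n} m≤n 0≤φ = Σ<-mono m≤n (λ a _ → Σ<-monoˡ m≤n (0≤φ a)) (λ a → Σ<-nonNeg n (0≤φ a))

Σ□-mono : ∀ n {φ ψ} → (∀ a c → φ a c ≤ ψ a c) → Σ□ n φ ≤ Σ□ n ψ
Σ□-mono n φ≤ψ = Σ<-monoʳ n λ a _ → Σ<-monoʳ n λ c _ → φ≤ψ a c

Σ△-mono : ∀ n {φ ψ} → (∀ a c → φ a c ≤ ψ a c) → Σ△ n φ ≤ Σ△ n ψ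
Σ△-mono n φ≤ψ = Σ<-monoʳ n λ a _ → Σ<-monoʳ (n ∸ a) λ c _ → φ≤ψ a c

Σ△≤Σ□ : ∀ n {φ} → Nonneg φ → Σ△ n φ ≤ Σ□ n φ
Σ△≤Σ□ n 0≤φ = Σ<-monoʳ n λ a _ → Σ<-monoˡ (ℕ.m∸n≤m n a) (0≤φ a)

Σ□≤Σ△ : ∀ n {φ} → Nonneg φ → Σ□ n φ ≤ Σ△ (n ℕ.+ n) φ
Σ□≤Σ△ n 0≤φ = Σ<-mono (ℕ.m≤m+n n n)
  (λ a a<n → Σ<-monoˡ (n≤n+n∸a a<n) (0≤φ a))
  (λ a → Σ<-nonNeg (n ℕ.+ n ∸ a) (0≤φ a))
  where
  n≤n+n∸a : ∀ {a} → a ℕ.< n → n ℕ.≤ n ℕ.+ n ∸ a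
  n≤n+n∸a a<n = subst (n ℕ.≤_) (sym (ℕ.+-∸-assoc n (ℕ.<⇒≤ a<n))) (ℕ.m≤m+n n _)

Σ□-*ₚ : ∀ n P Q → Σ□ n (P *ₚ Q) ≡ Σ△ n (λ a c → Σ△ n (λ b d → P a b * Q c d))
Σ□-*ₚ n P Q = begin
  (Σ< n λ i → Σ< n λ j → Σ< (suc i) λ a → Σ< (suc j) λ b → P a b * Q (i ∸ a) (j ∸ b))
    ≡⟨ Σ<-cong n (λ i _ → Σ<-comm n (suc i) _) ⟩
  (Σ< n λ i → Σ< (suc i) λ a → Σ< n λ j → Σ< (suc j) λ b → P a b * Q (i ∸ a) (j ∸ b))
    ≡⟨ Σ<-cong n (λ i _ → Σ<-cong (suc i) λ a _ → Σ<-antidiagonal n (λ b d → P a b * Q (i ∸ a) d)) ⟩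
  (Σ< n λ i → Σ< (suc i) λ a → Σ△ n λ b d → P a b * Q (i ∸ a) d)
    ≡⟨ Σ<-antidiagonal n (λ a c → Σ△ n λ b d → P a b * Q c d) ⟩
  Σ△ n (λ a c → Σ△ n (λ b d → P a b * Q c d)) ∎
  where open ≡-Reasoning

Σ□*Σ□ : ∀ n P Q → Σ□ n P * Σ□ n Q ≡ Σ□ n (λ a c → Σ□ n (λ b d → P a b * Q c d))
Σ□*Σ□ n P Q = begin
  Σ□ n P * Σ□ n Q
    ≡⟨ trans (Σ<-* n _ _) (Σ<-cong n λ a _ → Σ<-* n _ _) ⟩
  (Σ< n λ a → Σ< n λ b → P a b * Σ□ n Q)
    ≡⟨ Σ<-cong n (λ a _ → Σ<-cong n λ b _ →
         trans (*-Σ< n (P a b) _) (Σ<-cong n λ c _ → *-Σ< n (P a b) (Q c))) ⟩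
  (Σ< n λ a → Σ< n λ b → Σ< n λ c → Σ< n λ d → P a b * Q c d)
    ≡⟨ Σ<-cong n (λ a _ → Σ<-comm n n _) ⟩
  Σ□ n (λ a c → Σ□ n (λ b d → P a b * Q c d)) ∎
  where open ≡-Reasoning

module _ {P Q : PS} (0≤P : Nonneg P) (0≤Q : Nonneg Q) where

  private
    0≤P*Q : ∀ a b c d → 0ℚ ≤ P a b * Q c d
    0≤P*Q a b c d = *-nonNeg (0≤P a b) (0≤Q c d)

  Σ□-*ₚ≤Σ□*Σ□ : ∀ n → Σ□ n (P *ₚ Q) ≤ Σ□ n P * Σ□ n Q
  Σ□-*ₚ≤Σ□*Σ□ n = begin
    Σ□ n (P *ₚ Q)                                  ≡⟨ Σ□-*ₚ n P Q ⟩
    Σ△ n (λ a c → Σ△ n (λ b d → P a b * Q c d))  ≤⟨ Σ△-mono n (λ a c → Σ△≤Σ□ n (λ b d → 0≤P*Q a b c d)) ⟩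
    Σ△ n (λ a c → Σ□ n (λ b d → P a b * Q c d))  ≤⟨ Σ△≤Σ□ n (λ a c → Σ□-nonNeg n (λ b d → 0≤P*Q a b c d)) ⟩
    Σ□ n (λ a c → Σ□ n (λ b d → P a b * Q c d))  ≡⟨ Σ□*Σ□ n P Q ⟨
    Σ□ n P * Σ□ n Q                                ∎
    where open ≤-Reasoning

  Σ□*Σ□≤Σ□-*ₚ : ∀ n → Σ□ n P * Σ□ n Q ≤ Σ□ (n ℕ.+ n) (P *ₚ Q)
  Σ□*Σ□≤Σ□-*ₚ n = begin
    Σ□ n P * Σ□ n Q                                  ≡⟨ Σ□*Σ□ n P Q ⟩
    Σ□ n (λ a c → Σ□ n (λ b d → P a b * Q c d))    ≤⟨ Σ□-mono n (λ a c → Σ□≤Σ△ n (λ b d → 0≤P*Q a b c d)) ⟩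
    Σ□ n (λ a c → Σ△ 2n (λ b d → P a b * Q c d))   ≤⟨ Σ□≤Σ△ n (λ a c → Σ△-nonNeg 2n (λ b d → 0≤P*Q a b c d)) ⟩
    Σ△ 2n (λ a c → Σ△ 2n (λ b d → P a b * Q c d))  ≡⟨ Σ□-*ₚ 2n P Q ⟨
    Σ□ 2n (P *ₚ Q)                                   ∎
    where
    open ≤-Reasoning
    2n : ℕ
    2n = n ℕ.+ n

½^-+ : ∀ m n → ½^ (m ℕ.+ n) ≡ ½^ m * ½^ n
½^-+ zero    n = sym (*-identityˡ (½^ n))
½^-+ (suc m) n = trans (cong (½ *_) (½^-+ m n)) (sym (*-assoc ½ (½^ m) (½^ n)))

½^-nonNeg : ∀ n → 0ℚ ≤ ½^ n
½^-nonNeg zero    = ≤ᵇ⇒≤ _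
½^-nonNeg (suc n) = *-nonNeg {½} (≤ᵇ⇒≤ _) (½^-nonNeg n)

n<2^n : ∀ n → n ℕ.< 2 ℕ.^ n
n<2^n zero    = s≤s z≤n
n<2^n (suc n) = subst₂ ℕ._≤_ (ℕ.+-comm (suc n) 1) (cong (2 ℕ.^ n ℕ.+_) (sym (ℕ.+-identityʳ _)))
  (ℕ.+-mono-≤ (n<2^n n) (ℕ.m^n>0 2 n))

-- Normalised ½^ n has no usable numerator/denominator; its unnormalised twin has 1 / 2^n.
½^ᵘ : ℕ → ℚᵘ.ℚᵘ
½^ᵘ zero    = ℚᵘ.1ℚᵘ
½^ᵘ (suc n) = ℚᵘ.½ ℚᵘ.* ½^ᵘ n

↥½^ᵘ : ∀ n → ℚᵘ.↥ ½^ᵘ n ≡ ℤ.+ 1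
↥½^ᵘ zero    = refl
↥½^ᵘ (suc n) with ½^ᵘ n | ↥½^ᵘ n
... | ℚᵘ.mkℚᵘ _ _ | refl = refl

↧½^ᵘ : ∀ n → ℚᵘ.↧ₙ ½^ᵘ n ≡ 2 ℕ.^ n
↧½^ᵘ zero    = refl
↧½^ᵘ (suc n) with ½^ᵘ n | ↧½^ᵘ n
... | ℚᵘ.mkℚᵘ _ _ | eq = cong (2 ℕ.*_) eq

toℚᵘ-½^ : ∀ n → toℚᵘ (½^ n) ℚᵘ.≃ ½^ᵘ n
toℚᵘ-½^ zero    = ℚᵘ.≃-refl
toℚᵘ-½^ (suc n) = ℚᵘ.≃-trans (toℚᵘ-homo-* ½ (½^ n)) (ℚᵘ.*-congˡ {ℚᵘ.½} (toℚᵘ-½^ n))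

½^-archimedean : ∀ ε → Positive ε → ∃ λ K → ½^ K ≤ ε
½^-archimedean (mkℚ ℤ.+[1+ m ] d _) _ =
  d , toℚᵘ-cancel-≤ (ℚᵘ.≤-respˡ-≃ (ℚᵘ.≃-sym (toℚᵘ-½^ d)) (ℚᵘ.*≤* cross))
  where
  cross : ℚᵘ.↥ ½^ᵘ d ℤ.* ℤ.+ suc d ℤ.≤ ℤ.+[1+ m ] ℤ.* ℚᵘ.↧ ½^ᵘ d
  cross = subst₂ ℤ._≤_
    (sym (trans (cong (ℤ._* ℤ.+ suc d) (↥½^ᵘ d)) (ℤ.*-identityˡ _)))
    (trans (ℤ.pos-* (suc m) (2 ℕ.^ d)) (cong (λ k → ℤ.+[1+ m ] ℤ.* ℤ.+ k) (sym (↧½^ᵘ d))))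
    (+≤+ (ℕ.≤-trans (n<2^n d) (ℕ.m≤n*m (2 ℕ.^ d) (suc m))))

-- The series F(α/2, β/2); wsum F K is definitionally Σ□ K (halved F).
halved : PS → PS
halved F i j = ½^ (i ℕ.+ j) * F i j

halved-nonNeg : ∀ {F} → Nonneg F → Nonneg (halved F)
halved-nonNeg 0≤F i j = *-nonNeg (½^-nonNeg (i ℕ.+ j)) (0≤F i j)

halved-*ₚ : ∀ F G i j → halved (F *ₚ G) i j ≡ (halved F *ₚ halved G) i j
halved-*ₚ F G i j =
  trans (*-Σ< (suc i) (½^ (i ℕ.+ j)) _) (Σ<-cong (suc i) λ a a≤i →
  trans (*-Σ< (suc j) (½^ (i ℕ.+ j)) _) (Σ<-cong (suc j) λ b b≤j →
  split a b (ℕ.≤-pred a≤i) (ℕ.≤-pred b≤j)))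
  where
  split : ∀ a b → a ℕ.≤ i → b ℕ.≤ j →
    ½^ (i ℕ.+ j) * (F a b * G (i ∸ a) (j ∸ b)) ≡ halved F a b * halved G (i ∸ a) (j ∸ b)
  split a b a≤i b≤j = begin
    ½^ (i ℕ.+ j) * (F a b * G i' j')
      ≡⟨ cong (λ k → ½^ k * (F a b * G i' j')) (sym indices) ⟩
    ½^ ((a ℕ.+ b) ℕ.+ (i' ℕ.+ j')) * (F a b * G i' j')
      ≡⟨ cong (_* (F a b * G i' j')) (½^-+ (a ℕ.+ b) (i' ℕ.+ j')) ⟩
    (½^ (a ℕ.+ b) * ½^ (i' ℕ.+ j')) * (F a b * G i' j')
      ≡⟨ solve 4 (λ p q u v → (p :* q) :* (u :* v) := (p :* u) :* (q :* v)) refl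
           (½^ (a ℕ.+ b)) (½^ (i' ℕ.+ j')) (F a b) (G i' j') ⟩
    halved F a b * halved G i' j' ∎
    where
    open ≡-Reasoning
    i' = i ∸ a
    j' = j ∸ b
    indices : (a ℕ.+ b) ℕ.+ (i' ℕ.+ j') ≡ i ℕ.+ j
    indices = trans (interchange a b i' j') (cong₂ ℕ._+_ (ℕ.m+[n∸m]≡n a≤i) (ℕ.m+[n∸m]≡n b≤j))

wsum-nonNeg : ∀ {F} → Nonneg F → ∀ K → 0ℚ ≤ wsum F K
wsum-nonNeg 0≤F K = Σ□-nonNeg K (halved-nonNeg 0≤F)

wsum-mono : ∀ {F m n} → Nonneg F → m ℕ.≤ n → wsum F m ≤ wsum F n
wsum-mono 0≤F m≤n = Σ□-monoˡ m≤n (halved-nonNeg 0≤F)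

wsum-+ₚ : ∀ F G K → wsum (F +ₚ G) K ≡ wsum F K + wsum G K
wsum-+ₚ F G K = trans
  (Σ<-cong K λ i _ → trans (Σ<-cong K λ j _ → *-distribˡ-+ (½^ (i ℕ.+ j)) (F i j) (G i j))
                           (Σ<-+ K (halved F i) (halved G i)))
  (Σ<-+ K _ _)

wsum-*ₚ : ∀ F G K → wsum (F *ₚ G) K ≡ Σ□ K (halved F *ₚ halved G)
wsum-*ₚ F G K = Σ<-cong K λ i _ → Σ<-cong K λ j _ → halved-*ₚ F G i j

wsum-*ₚ≤wsum*wsum : ∀ {F G} → Nonneg F → Nonneg G → ∀ K → wsum (F *ₚ G) K ≤ wsum F K * wsum G K
wsum-*ₚ≤wsum*wsum {F} {G} 0≤F 0≤G K = subst (_≤ wsum F K * wsum G K) (sym (wsum-*ₚ F G K))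
  (Σ□-*ₚ≤Σ□*Σ□ (halved-nonNeg 0≤F) (halved-nonNeg 0≤G) K)

wsum*wsum≤wsum-*ₚ : ∀ {F G} → Nonneg F → Nonneg G → ∀ K → wsum F K * wsum G K ≤ wsum (F *ₚ G) (K ℕ.+ K)
wsum*wsum≤wsum-*ₚ {F} {G} 0≤F 0≤G K = subst (wsum F K * wsum G K ≤_) (sym (wsum-*ₚ F G (K ℕ.+ K)))
  (Σ□*Σ□≤Σ□-*ₚ (halved-nonNeg 0≤F) (halved-nonNeg 0≤G) K)

wsum-separable : ∀ {F} (f g : ℕ → ℚ) → (∀ i j → F i j ≡ f i * g j) →
  ∀ K → wsum F K ≡ Σ< K (λ i → ½^ i * f i) * Σ< K (λ j → ½^ j * g j)
wsum-separable {F} f g F≡f*g K = begin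
  wsum F K
    ≡⟨ Σ<-cong K (λ i _ → Σ<-cong K λ j _ → separate i j) ⟩
  (Σ< K λ i → Σ< K λ j → (½^ i * f i) * (½^ j * g j))
    ≡⟨ sym (trans (Σ<-* K _ _) (Σ<-cong K λ i _ → *-Σ< K (½^ i * f i) _)) ⟩
  Σ< K (λ i → ½^ i * f i) * Σ< K (λ j → ½^ j * g j) ∎
  where
  open ≡-Reasoning
  separate : ∀ i j → ½^ (i ℕ.+ j) * F i j ≡ (½^ i * f i) * (½^ j * g j)
  separate i j = trans (cong₂ _*_ (½^-+ i j) (F≡f*g i j))
    (solve 4 (λ p q u v → (p :* q) :* (u :* v) := (p :* u) :* (q :* v)) refl (½^ i) (½^ j) (f i) (g j))

record HasValue (F : PS) (v : ℚ) : Set where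
  field
    nonneg : Nonneg F
    wsum≤  : ∀ K → wsum F K ≤ v
    wsum≥  : ∀ ε → Positive ε → ∃ λ K → v - ε ≤ wsum F K

open HasValue

wsum-converges : ∀ {F v} → HasValue F v →
  (ε : ℚ) → Positive ε → Σ ℕ λ K₀ → (K : ℕ) → K ≥ K₀ → ∣ wsum F K - v ∣ ≤ ε
wsum-converges {F} {v} hv ε ε>0 with wsum≥ hv ε ε>0
... | K₀ , v-ε≤wsum = K₀ , λ K K≥K₀ →
  subst (_≤ ε) (sym (∣S-v∣≡v-S (wsum F K) (wsum≤ hv K)))
    (p-q≤r⇒p-r≤q {v} (≤-trans v-ε≤wsum (wsum-mono (nonneg hv) K≥K₀)))
  where
  ∣S-v∣≡v-S : ∀ S → S ≤ v → ∣ S - v ∣ ≡ v - S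
  ∣S-v∣≡v-S S S≤v = begin
    ∣ S - v ∣       ≡⟨ cong ∣_∣ (solve 2 (λ S v → S :- v := :- (v :- S)) refl S v) ⟩
    ∣ - (v - S) ∣   ≡⟨ ∣-p∣≡∣p∣ (v - S) ⟩
    ∣ v - S ∣       ≡⟨ 0≤p⇒∣p∣≡p (p≤q⇒0≤q-p S≤v) ⟩
    v - S           ∎
    where open ≡-Reasoning

hasValue-+ₚ : ∀ {F G v w} → HasValue F v → HasValue G w → HasValue (F +ₚ G) (v + w)
hasValue-+ₚ {F} {G} {v} {w} hF hG = record
  { nonneg = λ i j → +-mono-≤ (nonneg hF i j) (nonneg hG i j)
  ; wsum≤  = λ K → subst (_≤ v + w) (sym (wsum-+ₚ F G K)) (+-mono-≤ (wsum≤ hF K) (wsum≤ hG K))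
  ; wsum≥  = approx
  }
  where
  approx : ∀ ε → Positive ε → ∃ λ K → (v + w) - ε ≤ wsum (F +ₚ G) K
  approx ε ε>0 = combine (wsum≥ hF (½ * ε) ½ε>0) (wsum≥ hG (½ * ε) ½ε>0)
    where
    ½ε>0 : Positive (½ * ε)
    ½ε>0 = pos*pos⇒pos ½ ε {{ε>0}}
    halves : (v - ½ * ε) + (w - ½ * ε) ≡ (v + w) - ε
    halves = trans (solve 3 (λ v w e → (v :- e) :+ (w :- e) := (v :+ w) :- (e :+ e)) refl v w (½ * ε))
                   (cong (λ e → (v + w) - e) (½*p+½*p≡p ε))
    combine : (∃ λ K → v - ½ * ε ≤ wsum F K) → (∃ λ K → w - ½ * ε ≤ wsum G K) →
              ∃ λ K → (v + w) - ε ≤ wsum (F +ₚ G) K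
    combine (K₁ , hK₁) (K₂ , hK₂) = K , subst₂ _≤_ halves (sym (wsum-+ₚ F G K))
      (+-mono-≤ (≤-trans hK₁ (wsum-mono (nonneg hF) (ℕ.m≤m⊔n K₁ K₂)))
                (≤-trans hK₂ (wsum-mono (nonneg hG) (ℕ.m≤n⊔m K₁ K₂))))
      where K = K₁ ℕ.⊔ K₂

-- v w - X Y = v (w - Y) + Y (v - X)
*-approx : ∀ {v w X Y η} → 0ℚ ≤ v → 0ℚ ≤ Y → X ≤ v → Y ≤ w → v - η ≤ X → w - η ≤ Y →
  v * w - η * (v + w) ≤ X * Y
*-approx {v} {w} {X} {Y} {η} 0≤v 0≤Y X≤v Y≤w v-η≤X w-η≤Y = p-q≤r⇒p-r≤q {v * w}
  (subst₂ _≤_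
    (solve 4 (λ v w X Y → v :* (w :- Y) :+ Y :* (v :- X) := v :* w :- X :* Y) refl v w X Y)
    (solve 3 (λ v w η → v :* η :+ w :* η := η :* (v :+ w)) refl v w η)
    (+-mono-≤ (*-monoˡ-≤-nonNeg v {{nonNegative 0≤v}} (p-q≤r⇒p-r≤q {w} w-η≤Y))
              (*-mono-≤-nonNeg 0≤Y (p≤q⇒0≤q-p X≤v) Y≤w (p-q≤r⇒p-r≤q {v} v-η≤X))))

hasValue-*ₚ : ∀ {F G v w} → HasValue F v → HasValue G w → HasValue (F *ₚ G) (v * w)
hasValue-*ₚ {F} {G} {v} {w} hF hG = record
  { nonneg = λ i j → Σ<-nonNeg (suc i) λ a → Σ<-nonNeg (suc j) λ b →
               *-nonNeg (nonneg hF a b) (nonneg hG (i ∸ a) (j ∸ b))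
  ; wsum≤  = λ K → ≤-trans (wsum-*ₚ≤wsum*wsum (nonneg hF) (nonneg hG) K)
               (*-mono-≤-nonNeg (wsum-nonNeg (nonneg hF) K) (wsum-nonNeg (nonneg hG) K) (wsum≤ hF K) (wsum≤ hG K))
  ; wsum≥  = approx
  }
  where
  0≤v : 0ℚ ≤ v
  0≤v = ≤-trans (wsum-nonNeg (nonneg hF) 0) (wsum≤ hF 0)
  0≤w : 0ℚ ≤ w
  0≤w = ≤-trans (wsum-nonNeg (nonneg hG) 0) (wsum≤ hG 0)
  r : ℚ
  r = (v + w) + 1ℚ
  instance
    r>0 : Positive r
    r>0 = nonNeg+pos⇒pos (v + w) {{nonNegative (+-mono-≤ 0≤v 0≤w)}} 1ℚ
    r≢0 : NonZero r
    r≢0 = pos⇒nonZero r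

  approx : ∀ ε → Positive ε → ∃ λ K → v * w - ε ≤ wsum (F *ₚ G) K
  approx ε ε>0 = combine (wsum≥ hF η η>0) (wsum≥ hG η η>0)
    where
    η = ε * 1/ r
    η>0 : Positive η
    η>0 = pos*pos⇒pos ε {{ε>0}} (1/ r) {{1/pos⇒pos r}}
    η[v+w]≤ε : η * (v + w) ≤ ε
    η[v+w]≤ε = subst (η * (v + w) ≤_) ηr≡ε
      (*-monoˡ-≤-nonNeg η {{pos⇒nonNeg η {{η>0}}}} (p≤p+q (v + w) (≤ᵇ⇒≤ _)))
      where
      ηr≡ε : η * r ≡ ε
      ηr≡ε = trans (*-assoc ε (1/ r) r) (trans (cong (ε *_) (*-inverseˡ r)) (*-identityʳ ε))
    combine : (∃ λ K → v - η ≤ wsum F K) → (∃ λ K → w - η ≤ wsum G K) →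
              ∃ λ K → v * w - ε ≤ wsum (F *ₚ G) K
    combine (K₁ , hK₁) (K₂ , hK₂) = K ℕ.+ K , (begin
      v * w - ε                ≤⟨ +-monoʳ-≤ (v * w) (neg-antimono-≤ η[v+w]≤ε) ⟩
      v * w - η * (v + w)      ≤⟨ *-approx 0≤v (wsum-nonNeg (nonneg hG) K) (wsum≤ hF K) (wsum≤ hG K) v-η≤X w-η≤Y ⟩
      wsum F K * wsum G K      ≤⟨ wsum*wsum≤wsum-*ₚ (nonneg hF) (nonneg hG) K ⟩
      wsum (F *ₚ G) (K ℕ.+ K)  ∎)
      where
      open ≤-Reasoning
      K = K₁ ℕ.⊔ K₂
      v-η≤X : v - η ≤ wsum F K
      v-η≤X = ≤-trans hK₁ (wsum-mono (nonneg hF) (ℕ.m≤m⊔n K₁ K₂))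
      w-η≤Y : w - η ≤ wsum G K
      w-η≤Y = ≤-trans hK₂ (wsum-mono (nonneg hG) (ℕ.m≤n⊔m K₁ K₂))

hasValue-eventually : ∀ {F v} K₀ → Nonneg F → (∀ K → wsum F (K₀ ℕ.+ K) ≡ v) → HasValue F v
hasValue-eventually {F} {v} K₀ 0≤F stable = record
  { nonneg = 0≤F
  ; wsum≤  = λ K → subst (wsum F K ≤_) (stable K) (wsum-mono 0≤F (ℕ.m≤n+m K K₀))
  ; wsum≥  = λ ε ε>0 → K₀ ℕ.+ 0 , subst (v - ε ≤_) (sym (stable 0))
               (p-q≤r⇒p-r≤q {v} (subst (_≤ ε) (sym (+-inverseʳ v)) (<⇒≤ (positive⁻¹ ε {{ε>0}}))))
  }

2ℚ : ℚ
2ℚ = 1ℚ + 1ℚ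

2ℚ*½^1+n : ∀ n → 2ℚ * ½^ (suc n) ≡ ½^ n
2ℚ*½^1+n n = trans (sym (*-assoc 2ℚ ½ (½^ n))) (*-identityˡ (½^ n))

geometric : ∀ K → Σ< K (λ i → ½^ i * 1ℚ) + 2ℚ * ½^ K ≡ 2ℚ
geometric zero    = refl
geometric (suc K) = begin
  (S + ½^ K * 1ℚ) + 2ℚ * ½^ (suc K)  ≡⟨ cong ((S + ½^ K * 1ℚ) +_) (2ℚ*½^1+n K) ⟩
  (S + ½^ K * 1ℚ) + ½^ K              ≡⟨ solve 2 (λ s x → (s :+ x :* con 1ℚ) :+ x := s :+ (con 1ℚ :+ con 1ℚ) :* x) refl S (½^ K) ⟩
  S + 2ℚ * ½^ K                        ≡⟨ geometric K ⟩
  2ℚ                                   ∎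
  where
  open ≡-Reasoning
  S = Σ< K (λ i → ½^ i * 1ℚ)

hasValue-geometric : ∀ {F} → Nonneg F → (∀ K → wsum F K ≡ Σ< K (λ i → ½^ i * 1ℚ)) → HasValue F 2ℚ
hasValue-geometric {F} 0≤F wsum≡ = record
  { nonneg = 0≤F
  ; wsum≤  = λ K → subst₂ _≤_ (sym (wsum≡ K)) (geometric K)
               (p≤p+q _ (*-nonNeg {2ℚ} (≤ᵇ⇒≤ _) (½^-nonNeg K)))
  ; wsum≥  = approx
  }
  where
  approx : ∀ ε → Positive ε → ∃ λ K → 2ℚ - ε ≤ wsum F K
  approx ε ε>0 with ½^-archimedean ε ε>0
  ... | K , ½^K≤ε = suc K , subst (2ℚ - ε ≤_) (sym (wsum≡ (suc K))) (p-q≤r⇒p-r≤q {2ℚ} (subst (_≤ ε) tail ½^K≤ε))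
    where
    S = Σ< (suc K) (λ i → ½^ i * 1ℚ)
    tail : ½^ K ≡ 2ℚ - S
    tail = begin
      ½^ K                      ≡⟨ sym (2ℚ*½^1+n K) ⟩
      2ℚ * ½^ (suc K)           ≡⟨ solve 2 (λ s t → t := (s :+ t) :- s) refl S (2ℚ * ½^ (suc K)) ⟩
      (S + 2ℚ * ½^ (suc K)) - S ≡⟨ cong (_- S) (geometric (suc K)) ⟩
      2ℚ - S                    ∎
      where open ≡-Reasoning

δ-nonNeg : ∀ i → 0ℚ ≤ δ i
δ-nonNeg zero    = ≤ᵇ⇒≤ _
δ-nonNeg (suc i) = ≤-refl

δ₁-nonNeg : ∀ i → 0ℚ ≤ δ₁ i
δ₁-nonNeg (suc zero)    = ≤ᵇ⇒≤ _
δ₁-nonNeg zero          = ≤-refl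
δ₁-nonNeg (suc (suc i)) = ≤-refl

Σ<½^δ : ∀ K → Σ< (suc K) (λ i → ½^ i * δ i) ≡ 1ℚ
Σ<½^δ zero    = refl
Σ<½^δ (suc K) = trans (cong₂ _+_ (Σ<½^δ K) (*-zeroʳ (½^ (suc K)))) refl

Σ<½^δ₁ : ∀ K → Σ< (2 ℕ.+ K) (λ i → ½^ i * δ₁ i) ≡ ½
Σ<½^δ₁ zero    = refl
Σ<½^δ₁ (suc K) = trans (cong₂ _+_ (Σ<½^δ₁ K) (*-zeroʳ (½^ (2 ℕ.+ K)))) (+-identityʳ ½)

hasValue-0ₚ : HasValue 0ₚ 0ℚ
hasValue-0ₚ = hasValue-eventually 0 (λ _ _ → ≤-refl) λ K →
  trans (Σ<-cong K λ i _ → trans (Σ<-cong K λ j _ → *-zeroʳ (½^ (i ℕ.+ j))) (Σ<-zero K)) (Σ<-zero K)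

hasValue-1ₚ : HasValue 1ₚ 1ℚ
hasValue-1ₚ = hasValue-eventually 1 (λ i j → *-nonNeg (δ-nonNeg i) (δ-nonNeg j)) λ K →
  trans (wsum-separable δ δ (λ _ _ → refl) (suc K)) (cong₂ _*_ (Σ<½^δ K) (Σ<½^δ K))

hasValue-αₚ : HasValue αₚ ½
hasValue-αₚ = hasValue-eventually 2 (λ i j → *-nonNeg (δ₁-nonNeg i) (δ-nonNeg j)) λ K →
  trans (wsum-separable δ₁ δ (λ _ _ → refl) (2 ℕ.+ K)) (cong₂ _*_ (Σ<½^δ₁ K) (Σ<½^δ (suc K)))

hasValue-βₚ : HasValue βₚ ½
hasValue-βₚ = hasValue-eventually 2 (λ i j → *-nonNeg (δ-nonNeg i) (δ₁-nonNeg j)) λ K →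
  trans (wsum-separable δ δ₁ (λ _ _ → refl) (2 ℕ.+ K)) (cong₂ _*_ (Σ<½^δ (suc K)) (Σ<½^δ₁ K))

hasValue-geoα : HasValue geoα 2ℚ
hasValue-geoα = hasValue-geometric (λ i j → δ-nonNeg j) λ K →
  trans (wsum-separable (λ _ → 1ℚ) δ (λ i j → sym (*-identityˡ (δ j))) K) (geo*Σ<½^δ K)
  where
  geo*Σ<½^δ : ∀ K → Σ< K (λ i → ½^ i * 1ℚ) * Σ< K (λ j → ½^ j * δ j) ≡ Σ< K (λ i → ½^ i * 1ℚ)
  geo*Σ<½^δ zero    = refl
  geo*Σ<½^δ (suc K) = trans (cong (geo *_) (Σ<½^δ K)) (*-identityʳ geo)
    where geo = Σ< (suc K) (λ i → ½^ i * 1ℚ)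

hasValue-geoβ : HasValue geoβ 2ℚ
hasValue-geoβ = hasValue-geometric (λ i j → δ-nonNeg i) λ K →
  trans (wsum-separable δ (λ _ → 1ℚ) (λ i j → sym (*-identityʳ (δ i))) K) (Σ<½^δ*geo K)
  where
  Σ<½^δ*geo : ∀ K → Σ< K (λ i → ½^ i * δ i) * Σ< K (λ j → ½^ j * 1ℚ) ≡ Σ< K (λ j → ½^ j * 1ℚ)
  Σ<½^δ*geo zero    = refl
  Σ<½^δ*geo (suc K) = trans (cong (_* geo) (Σ<½^δ K)) (*-identityˡ geo)
    where geo = Σ< (suc K) (λ j → ½^ j * 1ℚ)

record Stochastic (m : Mat) : Set where
  field
    va vb vc vd : ℚ
    has-a : HasValue (a m) va
    has-b : HasValue (b m) vb
    has-c : HasValue (c m) vc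
    has-d : HasValue (d m) vd
    row₁  : va + vb ≡ 1ℚ
    row₂  : vc + vd ≡ 1ℚ

open Stochastic

row-of-product : ∀ x y u v z w → x + y ≡ 1ℚ → u + v ≡ 1ℚ → z + w ≡ 1ℚ →
  (x * u + y * z) + (x * v + y * w) ≡ 1ℚ
row-of-product x y u v z w x+y≡1 u+v≡1 z+w≡1 = begin
  (x * u + y * z) + (x * v + y * w)
    ≡⟨ solve 6 (λ x y u v z w → (x :* u :+ y :* z) :+ (x :* v :+ y :* w) := x :* (u :+ v) :+ y :* (z :+ w))
         refl x y u v z w ⟩
  x * (u + v) + y * (z + w)  ≡⟨ cong₂ (λ p q → x * p + y * q) u+v≡1 z+w≡1 ⟩
  x * 1ℚ + y * 1ℚ            ≡⟨ cong₂ _+_ (*-identityʳ x) (*-identityʳ y) ⟩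
  x + y                      ≡⟨ x+y≡1 ⟩
  1ℚ                         ∎
  where open ≡-Reasoning

stochastic-⊗ : ∀ {m n} → Stochastic m → Stochastic n → Stochastic (m ⊗ n)
stochastic-⊗ {mat _ _ _ _} {mat _ _ _ _} s t = record
  { has-a = hasValue-+ₚ (hasValue-*ₚ (has-a s) (has-a t)) (hasValue-*ₚ (has-b s) (has-c t))
  ; has-b = hasValue-+ₚ (hasValue-*ₚ (has-a s) (has-b t)) (hasValue-*ₚ (has-b s) (has-d t))
  ; has-c = hasValue-+ₚ (hasValue-*ₚ (has-c s) (has-a t)) (hasValue-*ₚ (has-d s) (has-c t))
  ; has-d = hasValue-+ₚ (hasValue-*ₚ (has-c s) (has-b t)) (hasValue-*ₚ (has-d s) (has-d t))
  ; row₁  = row-of-product (va s) (vb s) (va t) (vb t) (vc t) (vd t) (row₁ s) (row₁ t) (row₂ t)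
  ; row₂  = row-of-product (vc s) (vd s) (va t) (vb t) (vc t) (vd t) (row₂ s) (row₁ t) (row₂ t)
  }

stochastic-I₂ : Stochastic I₂
stochastic-I₂ = record
  { has-a = hasValue-1ₚ ; has-b = hasValue-0ₚ ; has-c = hasValue-0ₚ ; has-d = hasValue-1ₚ
  ; row₁ = refl ; row₂ = refl }

stochastic-A₀ : Stochastic A₀
stochastic-A₀ = record
  { has-a = hasValue-1ₚ ; has-b = hasValue-0ₚ ; has-c = hasValue-αₚ ; has-d = hasValue-βₚ
  ; row₁ = refl ; row₂ = refl }

stochastic-A₁ : Stochastic A₁
stochastic-A₁ = record
  { has-a = hasValue-αₚ ; has-b = hasValue-βₚ ; has-c = hasValue-0ₚ ; has-d = hasValue-1ₚ
  ; row₁ = refl ; row₂ = refl }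

stochastic-A₀∞ : Stochastic A₀∞
stochastic-A₀∞ = record
  { has-a = hasValue-1ₚ ; has-b = hasValue-0ₚ ; has-c = hasValue-*ₚ hasValue-αₚ hasValue-geoβ ; has-d = hasValue-0ₚ
  ; row₁ = refl ; row₂ = refl }

stochastic-A₁∞ : Stochastic A₁∞
stochastic-A₁∞ = record
  { has-a = hasValue-0ₚ ; has-b = hasValue-*ₚ hasValue-βₚ hasValue-geoα ; has-c = hasValue-0ₚ ; has-d = hasValue-1ₚ
  ; row₁ = refl ; row₂ = refl }

stochastic-pow : ∀ {m} → Stochastic m → ∀ n → Stochastic (pow m n)
stochastic-pow s zero    = stochastic-I₂
stochastic-pow s (suc n) = stochastic-⊗ s (stochastic-pow s n)

stochastic-A₀^ : ∀ ℓ → Stochastic (A₀^ ℓ)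
stochastic-A₀^ (fin n) = stochastic-pow stochastic-A₀ (val n)
stochastic-A₀^ ∞       = stochastic-A₀∞

stochastic-A₁^ : ∀ k → Stochastic (A₁^ k)
stochastic-A₁^ (fin n) = stochastic-pow stochastic-A₁ (val n)
stochastic-A₁^ ∞       = stochastic-A₁∞

stochastic-M : ∀ {N} (t : Vec (ℕ̄₊ × ℕ̄₊) N) → Stochastic (M t)
stochastic-M []            = stochastic-I₂
stochastic-M ((k , ℓ) ∷ t) = stochastic-⊗ (stochastic-⊗ (stochastic-A₁^ k) (stochastic-A₀^ ℓ)) (stochastic-M t)

lemma2p2 : (N : ℕ) → N ≥ 1 → (t : Vec (ℕ̄₊ × ℕ̄₊) N) →
    ((ε : ℚ) → Positive ε → Σ ℕ λ K₀ → (K : ℕ) → K ≥ K₀ →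
        ∣ wsum (a (M t) +ₚ b (M t)) K - 1ℚ ∣ ≤ ε)
    × ((ε : ℚ) → Positive ε → Σ ℕ λ K₀ → (K : ℕ) → K ≥ K₀ →
        ∣ wsum (c (M t) +ₚ d (M t)) K - 1ℚ ∣ ≤ ε)
    × ((i j : ℕ) → (0ℚ ≤ a (M t) i j) × (0ℚ ≤ b (M t) i j)
                 × (0ℚ ≤ c (M t) i j) × (0ℚ ≤ d (M t) i j))
lemma2p2 N _ t =
    wsum-converges (subst (HasValue _) (row₁ s) (hasValue-+ₚ (has-a s) (has-b s)))
  , wsum-converges (subst (HasValue _) (row₂ s) (hasValue-+ₚ (has-c s) (has-d s)))
  , λ i j → nonneg (has-a s) i j , nonneg (has-b s) i j , nonneg (has-c s) i j , nonneg (has-d s) i j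
  where
  s : Stochastic (M t)
  s = stochastic-M t
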